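{- Let $G\leq\mathrm{Sym}(m)$ and $H\leq\mathrm{Sym}(n)$ be permutation groups that both have the EKR property (with respect to their natural actions). Then the wreath product $G\wr H$, acting on $\Omega=\{1,\dots,m\}\times\{1,\dots,n\}$ by $(x,j)^{(g_1,\dots,g_n,h)}=(g_j(x),h(j))$, has the EKR property.
   Context: The wreath product $G\wr H$ has underlying set $G^n\times H$ (elements $(g_1,\dots,g_n,h)$) with multiplication $(g_1,\dots,g_n,h)\cdot(g'_1,\dots,g'_n,h')=(g_1g'_{h(1)},\dots,g_ng'_{h(n)},hh')$. For a permutation group acting on a set, two elements $\pi,\tau$ intersect if $\pi\tau^{ -1}$ has a fixed point; a subset is intersecting if every pair of its elements intersect. A permutation group has the EKR property if every intersecting subset has size at most the size of the largest point-stabilizer. -}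

module Defs where

open import Level using (0ℓ)
open import Data.Nat using (ℕ; _≤_)
open import Data.Fin using (Fin)
open import Data.Product using (_×_; _,_; ∃; ∃-syntax; Σ-syntax)
open import Data.List using (List; length)
open import Data.List.Relation.Unary.All using (All)
open import Data.List.Relation.Unary.AllPairs using (AllPairs)
open import Function.Bundles using (_↔_; Inverse)
open import Function.Construct.Composition using (_↔-∘_)
open import Function.Construct.Identity using (↔-id)
open import Function.Construct.Symmetry using (↔-sym)
open import Relation.Binary.PropositionalEquality using (_≡_)
open import Relation.Nullary using (¬_)

open Inverse

Sym : Set → Set
Sym Ω = Ω ↔ Ω

_≈ₚ_ : {Ω : Set} → Sym Ω → Sym Ω → Set
π ≈ₚ τ = ∀ ω → to π ω ≡ to τ ω

record IsPermGroup {Ω : Set} (P : Sym Ω → Set) : Set₁ where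
  field
    resp  : ∀ {π τ} → π ≈ₚ τ → P π → P τ
    id∈   : P (↔-id Ω)
    ∘∈    : ∀ {π τ} → P π → P τ → P (π ↔-∘ τ)
    inv∈  : ∀ {π} → P π → P (↔-sym π)

Intersect : {Ω : Set} → Sym Ω → Sym Ω → Set
Intersect π τ = ∃[ ω ] to (π ↔-∘ ↔-sym τ) ω ≡ ω

IsSubsetOf : {Ω : Set} → (Sym Ω → Set) → List (Sym Ω) → Set
IsSubsetOf P L = All P L × AllPairs (λ π τ → ¬ (π ≈ₚ τ)) L

IsIntersecting : {Ω : Set} → (Sym Ω → Set) → List (Sym Ω) → Set
IsIntersecting P S = IsSubsetOf P S × AllPairs Intersect S

Stab : {Ω : Set} → (Sym Ω → Set) → Ω → Sym Ω → Set
Stab P ω π = P π × to π ω ≡ ω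

-- EKR property: every intersecting subset has size at most the size of the
-- largest point stabiliser, i.e. at most |Stab P ω| for some point ω
-- (witnessed by a duplicate-free list of elements of Stab P ω of at least
-- that length).
EKR : {Ω : Set} → (Sym Ω → Set) → Set
EKR {Ω} P = ∀ (S : List (Sym Ω)) → IsIntersecting P S →
  ∃[ ω ] ∃[ L ] (IsSubsetOf (Stab P ω) L × length S ≤ length L)

Wreath : {m n : ℕ} → (Sym (Fin m) → Set) → (Sym (Fin n) → Set) →
         Sym (Fin m × Fin n) → Set
Wreath {m} {n} G H σ =
  Σ[ g ∈ (Fin n → Sym (Fin m)) ] Σ[ h ∈ Sym (Fin n) ] ((∀ (j : Fin n) → G (g j)) × H h ×
    (∀ x j → to σ (x , j) ≡ (to (g j) x , to h j)))

-- Fix a point j of the top set and call two elements (g₁ … gₙ , h) of G ≀ H equivalent when their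
-- base tuples differ by a diagonal right factor, gᵢ' = gᵢ c for all i. An element is determined by
-- its class, its j-th base gⱼ and its top h. In an intersecting family S the tops form an
-- intersecting family in H, and within one class the j-th bases form an intersecting family in G.
-- Choosing j by EKR for the tops and then a point x by EKR for the largest family of j-th bases,
-- |S| ≤ #classes · |G_x| · |H_j|, and (ρ , u , h) ↦ ((ρᵢ ρⱼ⁻¹ u)ᵢ , h) embeds that many elements
-- into the stabiliser of (x , j).
module Submission where

open import Level using (0ℓ)
open import Data.Nat using (ℕ; suc; _+_; _*_; _≤_; z≤n; s≤s)
open import Data.Nat.Properties using (+-mono-≤; *-mono-≤; *-monoˡ-≤; *-monoʳ-≤; module ≤-Reasoning)
open import Data.Fin as Fin using (Fin)
open import Data.Fin.Properties using (all?)
open import Data.Product using (_×_; _,_; ∃-syntax; Σ; proj₁; proj₂)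
open import Data.Product.Relation.Binary.Pointwise.NonDependent using (_×ₛ_)
open import Data.Sum using (_⊎_; inj₁; inj₂)
import Data.Sum as Sum
open import Data.List using (List; []; _∷_; length; map; filter; concatMap; cartesianProduct; deduplicate; _++_)
open import Data.List.Properties using (length-map; length-++; length-removeAt′)
open import Data.List.Extrema.Nat using (argmax; argmax-all; f[xs]≤f[argmax])
open import Data.List.Relation.Unary.All as All using (All; []; _∷_)
import Data.List.Relation.Unary.All.Properties as All
open import Data.List.Relation.Unary.Any as Any using (Any; here; there; index)
import Data.List.Relation.Unary.Any.Properties as Any
open import Data.List.Relation.Unary.AllPairs as AllPairs using (AllPairs; []; _∷_)
import Data.List.Relation.Unary.AllPairs.Properties as AllPairs
import Data.List.Relation.Unary.Unique.Setoid.Properties as Unique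
open import Data.List.Relation.Unary.Unique.DecSetoid.Properties using (deduplicate-!)
open import Data.List.Membership.Propositional using (_∈_)
open import Data.List.Membership.Propositional.Properties using (∈-map⁺; ∈-filter⁺; ∈-cartesianProduct⁻)
import Data.List.Membership.Setoid as SetoidMembership
open import Function.Base using (_∘_)
open import Function.Bundles using (Inverse; mk↔ₛ′; Injection)
open import Function.Construct.Composition using (_↔-∘_)
open import Function.Construct.Symmetry using (↔-sym)
open import Function.Properties.Inverse using (↔⇒↣)
open import Relation.Binary using (Rel; Setoid; DecSetoid; Decidable)
open import Relation.Binary.PropositionalEquality using (_≡_; refl; sym; trans; cong; cong₂; subst; module ≡-Reasoning)
open import Relation.Nullary using (¬_; contradiction)
import Relation.Nullary.Decidable as Dec

open import Defs

open Inverse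

module _ {c ℓ} (S : Setoid c ℓ) where
  open Setoid S using (Carrier; _≈_) renaming (sym to ≈-sym; trans to ≈-trans)
  open SetoidMembership S using () renaming (_∈_ to _∈ₛ_; _─_ to _─ₛ_)

  ∈⇒≈⊎∈-─ : ∀ {x y ys} (p : x ∈ₛ ys) → y ∈ₛ ys → y ≈ x ⊎ y ∈ₛ (ys ─ₛ p)
  ∈⇒≈⊎∈-─ (here x≈z) (here y≈z) = inj₁ (≈-trans y≈z (≈-sym x≈z))
  ∈⇒≈⊎∈-─ (here _)   (there q)  = inj₂ q
  ∈⇒≈⊎∈-─ (there _)  (here y≈z) = inj₂ (here y≈z)
  ∈⇒≈⊎∈-─ (there p)  (there q)  = Sum.map₂ there (∈⇒≈⊎∈-─ p q)

  pigeonhole : ∀ {a} {A : Set a} (f : A → Carrier) {xs ys} →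
    AllPairs (λ x y → ¬ f x ≈ f y) xs → (∀ {x} → x ∈ xs → f x ∈ₛ ys) →
    length xs ≤ length ys
  pigeonhole f []                _     = z≤n
  pigeonhole f {x ∷ xs} {ys} (fx≉ ∷ fxs≉) cover = begin
    suc (length xs)        ≤⟨ s≤s (pigeonhole f fxs≉ cover′) ⟩
    suc (length (ys ─ₛ p)) ≡⟨ sym (length-removeAt′ ys (index p)) ⟩
    length ys              ∎
    where
    open ≤-Reasoning
    p : f x ∈ₛ ys
    p = cover (here refl)
    cover′ : ∀ {y} → y ∈ xs → f y ∈ₛ (ys ─ₛ p)
    cover′ y∈xs with ∈⇒≈⊎∈-─ p (cover (there y∈xs))
    ... | inj₁ fy≈fx = contradiction (≈-sym fy≈fx) (All.lookup fx≉ y∈xs)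
    ... | inj₂ fy∈   = fy∈

module _ {c ℓ} (S : DecSetoid c ℓ) where
  open DecSetoid S using (_≈_; _≟_; reflexive) renaming (sym to ≈-sym; trans to ≈-trans)

  ∈⇒∈-deduplicate : ∀ {x xs} → x ∈ xs → Any (x ≈_) (deduplicate _≟_ xs)
  ∈⇒∈-deduplicate x∈xs =
    Any.deduplicate⁺ _≟_ (λ z≈y x≈y → ≈-trans x≈y (≈-sym z≈y)) (Any.map reflexive x∈xs)

module _ {A : Set} {R S : Rel A 0ℓ} (R? : Decidable R) where

  AllPairs-deduplicate⁺ : ∀ {xs} → AllPairs S xs → AllPairs S (deduplicate R? xs)
  AllPairs-deduplicate⁺ []           = []
  AllPairs-deduplicate⁺ (sx ∷ sxs) =
    All.filter⁺ _ (All.deduplicate⁺ R? sx) ∷ AllPairs.filter⁺ _ (AllPairs-deduplicate⁺ sxs)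

module _ {A : Set} {P : A → Set} {R : Rel A 0ℓ} where

  All⇒AllPairs : (∀ {x y} → P x → P y → R x y) → ∀ {xs} → All P xs → AllPairs R xs
  All⇒AllPairs f []         = []
  All⇒AllPairs f (px ∷ pxs) = All.map (f px) pxs ∷ All⇒AllPairs f pxs

map-proj₁-toList : ∀ {A : Set} {P : A → Set} {xs} (pxs : All P xs) → map proj₁ (All.toList pxs) ≡ xs
map-proj₁-toList []         = refl
map-proj₁-toList (px ∷ pxs) = cong (_ ∷_) (map-proj₁-toList pxs)

length-cartesianProduct : ∀ {A B : Set} (xs : List A) (ys : List B) →
  length (cartesianProduct xs ys) ≡ length xs * length ys
length-cartesianProduct []       ys = refl
length-cartesianProduct (x ∷ xs) ys = begin
  length (map (x ,_) ys ++ cartesianProduct xs ys)        ≡⟨ length-++ (map (x ,_) ys) ⟩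
  length (map (x ,_) ys) + length (cartesianProduct xs ys) ≡⟨ cong₂ _+_ (length-map (x ,_) ys) (length-cartesianProduct xs ys) ⟩
  length ys + length xs * length ys                       ∎
  where open ≡-Reasoning

length-concatMap-≤ : ∀ {A B : Set} (f : A → List B) {M xs} →
  All (λ x → length (f x) ≤ M) xs → length (concatMap f xs) ≤ length xs * M
length-concatMap-≤ f []                           = z≤n
length-concatMap-≤ f {xs = x ∷ xs} (fx≤M ∷ fxs≤M) = begin
  length (f x ++ concatMap f xs)           ≡⟨ length-++ (f x) ⟩
  length (f x) + length (concatMap f xs)   ≤⟨ +-mono-≤ fx≤M (length-concatMap-≤ f fxs≤M) ⟩
  _                                        ∎
  where open ≤-Reasoning

≈ₚ-setoid : Set → Setoid 0ℓ 0ℓ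
≈ₚ-setoid Ω = record
  { Carrier       = Sym Ω
  ; _≈_           = _≈ₚ_
  ; isEquivalence = record
    { refl  = λ _ → refl
    ; sym   = λ π≈τ ω → sym (π≈τ ω)
    ; trans = λ π≈τ τ≈ρ ω → trans (π≈τ ω) (τ≈ρ ω)
    }
  }

≈ₚ-decSetoid : ℕ → DecSetoid 0ℓ 0ℓ
≈ₚ-decSetoid k = record
  { isDecEquivalence = record
    { isEquivalence = Setoid.isEquivalence (≈ₚ-setoid (Fin k))
    ; _≟_           = λ π τ → all? (λ ω → to π ω Fin.≟ to τ ω)
    }
  }

Agree : {Ω : Set} → Sym Ω → Sym Ω → Set
Agree π τ = ∃[ ω ] to π ω ≡ to τ ω

module _ {Ω : Set} {π τ : Sym Ω} where

  intersect⇒agree : Intersect π τ → Agree π τ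
  intersect⇒agree (ω , πτ⁻¹ω≡ω) = from τ ω , trans πτ⁻¹ω≡ω (sym (strictlyInverseˡ τ ω))

  agree⇒intersect : Agree π τ → Intersect π τ
  agree⇒intersect (ω , πω≡τω) = to τ ω , trans (cong (to π) (strictlyInverseʳ τ ω)) πω≡τω

wreathPerm : ∀ {m n} → (Fin n → Sym (Fin m)) → Sym (Fin n) → Sym (Fin m × Fin n)
wreathPerm {m} {n} g h = mk↔ₛ′ act act⁻¹ act∘act⁻¹ act⁻¹∘act
  where
  act : Fin m × Fin n → Fin m × Fin n
  act (x , i) = to (g i) x , to h i
  act⁻¹ : Fin m × Fin n → Fin m × Fin n
  act⁻¹ (y , k) = from (g (from h k)) y , from h k
  act∘act⁻¹ : ∀ ω → act (act⁻¹ ω) ≡ ω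
  act∘act⁻¹ (y , k) = cong₂ _,_ (strictlyInverseˡ (g (from h k)) y) (strictlyInverseˡ h k)
  act⁻¹∘act : ∀ ω → act⁻¹ (act ω) ≡ ω
  act⁻¹∘act (x , i) = lemma (from h (to h i)) (strictlyInverseʳ h i)
    where
    lemma : ∀ k → k ≡ i → (from (g k) (to (g i) x) , k) ≡ (x , i)
    lemma _ refl = cong (_, i) (strictlyInverseʳ (g i) x)

module WreathProduct {m n : ℕ} (G : Sym (Fin m) → Set) (H : Sym (Fin n) → Set) where

  Ω : Set
  Ω = Fin m × Fin n

  Elt : Set
  Elt = Σ (Sym Ω) (Wreath G H)

  perm : Elt → Sym Ω
  perm = proj₁

  base : Elt → Fin n → Sym (Fin m)
  base (_ , g , _) = g

  top : Elt → Sym (Fin n)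
  top (_ , _ , h , _) = h

  base∈G : ∀ e i → G (base e i)
  base∈G (_ , _ , _ , g∈G , _) = g∈G

  top∈H : ∀ e → H (top e)
  top∈H (_ , _ , _ , _ , h∈H , _) = h∈H

  acts : ∀ e x i → to (perm e) (x , i) ≡ (to (base e i) x , to (top e) i)
  acts (_ , _ , _ , _ , _ , act) = act

  agree-components : ∀ {e e'} x i → to (perm e) (x , i) ≡ to (perm e') (x , i) →
    to (base e i) x ≡ to (base e' i) x × to (top e) i ≡ to (top e') i
  agree-components {e} {e'} x i eq =
    cong proj₁ eq′ , cong proj₂ eq′
    where
    eq′ : (to (base e i) x , to (top e) i) ≡ (to (base e' i) x , to (top e') i)
    eq′ = trans (sym (acts e x i)) (trans eq (acts e' x i))

  agree⇒agree-top : ∀ {e e'} → Agree (perm e) (perm e') → Agree (top e) (top e')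
  agree⇒agree-top {e} {e'} ((x , i) , eq) = i , proj₂ (agree-components {e} {e'} x i eq)

  module Classes (j : Fin n) where

    -- gᵢ gⱼ⁻¹ = gᵢ' gⱼ'⁻¹ for all i, i.e. gᵢ' = gᵢ c with the single c = gⱼ⁻¹ gⱼ'.
    record _∼_ (e e' : Elt) : Set where
      constructor mk∼
      field normalised-≡ : ∀ i y → to (base e i) (from (base e j) y) ≡ to (base e' i) (from (base e' j) y)
    open _∼_

    ∼-decSetoid : DecSetoid 0ℓ 0ℓ
    ∼-decSetoid = record
      { Carrier          = Elt
      ; _≈_              = _∼_
      ; isDecEquivalence = record
        { isEquivalence = record
          { refl  = mk∼ λ _ _ → refl
          ; sym   = λ e∼e' → mk∼ λ i y → sym (normalised-≡ e∼e' i y)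
          ; trans = λ e∼e' e'∼e'' → mk∼ λ i y → trans (normalised-≡ e∼e' i y) (normalised-≡ e'∼e'' i y)
          }
        ; _≟_ = λ e e' → Dec.map′ mk∼ normalised-≡ (all? λ i → all? λ y →
            to (base e i) (from (base e j) y) Fin.≟ to (base e' i) (from (base e' j) y))
        }
      }

    ∼⇒base-factor : ∀ {e e'} → e ∼ e' → ∀ i x →
      to (base e i) x ≡ to (base e' i) (from (base e' j) (to (base e j) x))
    ∼⇒base-factor {e} {e'} e∼e' i x = begin
      to (base e i) x                                      ≡⟨ cong (to (base e i)) (sym (strictlyInverseʳ (base e j) x)) ⟩
      to (base e i) (from (base e j) (to (base e j) x))    ≡⟨ normalised-≡ e∼e' i (to (base e j) x) ⟩
      to (base e' i) (from (base e' j) (to (base e j) x))  ∎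
      where open ≡-Reasoning

    ∼∧base≈∧top≈⇒≈ : ∀ {e e'} → e ∼ e' → base e j ≈ₚ base e' j → top e ≈ₚ top e' → perm e ≈ₚ perm e'
    ∼∧base≈∧top≈⇒≈ {e} {e'} e∼e' gⱼ≈gⱼ' h≈h' (x , i) = begin
      to (perm e) (x , i)                  ≡⟨ acts e x i ⟩
      to (base e i) x , to (top e) i       ≡⟨ cong₂ _,_ gᵢx≡gᵢ'x (h≈h' i) ⟩
      to (base e' i) x , to (top e') i     ≡⟨ sym (acts e' x i) ⟩
      to (perm e') (x , i)                 ∎
      where
      open ≡-Reasoning
      gᵢx≡gᵢ'x : to (base e i) x ≡ to (base e' i) x
      gᵢx≡gᵢ'x = begin
        to (base e i) x                                       ≡⟨ ∼⇒base-factor e∼e' i x ⟩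
        to (base e' i) (from (base e' j) (to (base e j) x))   ≡⟨ cong (λ y → to (base e' i) (from (base e' j) y)) (gⱼ≈gⱼ' x) ⟩
        to (base e' i) (from (base e' j) (to (base e' j) x))  ≡⟨ cong (to (base e' i)) (strictlyInverseʳ (base e' j) x) ⟩
        to (base e' i) x                                      ∎

    ∼∧agree⇒agree-base : ∀ {e e'} → e ∼ e' → Agree (perm e) (perm e') → Agree (base e j) (base e' j)
    ∼∧agree⇒agree-base {e} {e'} e∼e' ((x , k) , eq) = x , sym (inverseˡ (base e' j) (sym c⁻¹x≡x))
      where
      c⁻¹x≡x : from (base e' j) (to (base e j) x) ≡ x
      c⁻¹x≡x = Injection.injective (↔⇒↣ (base e' k))
        (trans (sym (∼⇒base-factor e∼e' k x)) (proj₁ (agree-components {e} {e'} x k eq)))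

    Cell : Set
    Cell = Elt × (Sym (Fin m) × Sym (Fin n))

    cellSetoid : Setoid 0ℓ 0ℓ
    cellSetoid = DecSetoid.setoid ∼-decSetoid ×ₛ (≈ₚ-setoid (Fin m) ×ₛ ≈ₚ-setoid (Fin n))

    open Setoid cellSetoid using () renaming (_≈_ to _≈ᶜ_)

    profile : Elt → Cell
    profile e = e , base e j , top e

    profile-injective : ∀ {e e'} → profile e ≈ᶜ profile e' → perm e ≈ₚ perm e'
    profile-injective (e∼e' , gⱼ≈gⱼ' , h≈h') = ∼∧base≈∧top≈⇒≈ e∼e' gⱼ≈gⱼ' h≈h'

    lift : Cell → Sym Ω
    lift (ρ , u , h) = wreathPerm (λ i → base ρ i ↔-∘ (↔-sym (base ρ j) ↔-∘ u)) h

    lift∈Stab : IsPermGroup G → ∀ {x} ρ {u h} → Stab G x u → Stab H j h →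
      Stab (Wreath G H) (x , j) (lift (ρ , u , h))
    lift∈Stab G-group ρ {u} (u∈G , ux≡x) (h∈H , hj≡j) =
      (_ , _ , base′∈G , h∈H , λ _ _ → refl) ,
      cong₂ _,_ (trans (strictlyInverseˡ (base ρ j) (to u _)) ux≡x) hj≡j
      where
      open IsPermGroup G-group
      base′∈G : ∀ i → G (base ρ i ↔-∘ (↔-sym (base ρ j) ↔-∘ u))
      base′∈G i = ∘∈ (base∈G ρ i) (∘∈ (inv∈ (base∈G ρ j)) u∈G)

    -- The point of Fin m is needed to read the top off the action.
    lift-injective : Fin m → ∀ {c c'} → lift c ≈ₚ lift c' → c ≈ᶜ c'
    lift-injective x₀ {ρ , u , h} {ρ' , u' , h'} eq = ρ∼ρ' , u≈u' , h≈h'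
      where
      open ≡-Reasoning
      h≈h' : h ≈ₚ h'
      h≈h' i = cong proj₂ (eq (x₀ , i))
      u≈u' : u ≈ₚ u'
      u≈u' y = begin
        to u y                                          ≡⟨ sym (strictlyInverseˡ (base ρ j) (to u y)) ⟩
        to (base ρ j) (from (base ρ j) (to u y))        ≡⟨ cong proj₁ (eq (y , j)) ⟩
        to (base ρ' j) (from (base ρ' j) (to u' y))     ≡⟨ strictlyInverseˡ (base ρ' j) (to u' y) ⟩
        to u' y                                         ∎
      ρ∼ρ' : ρ ∼ ρ'
      ρ∼ρ' = mk∼ λ i z → begin
        to (base ρ i) (from (base ρ j) z)                          ≡⟨ cong (λ w → to (base ρ i) (from (base ρ j) w)) (sym (strictlyInverseˡ u z)) ⟩
        to (base ρ i) (from (base ρ j) (to u (from u z)))          ≡⟨ cong proj₁ (eq (from u z , i)) ⟩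
        to (base ρ' i) (from (base ρ' j) (to u' (from u z)))       ≡⟨ cong (λ w → to (base ρ' i) (from (base ρ' j) w)) (trans (sym (u≈u' (from u z))) (strictlyInverseˡ u z)) ⟩
        to (base ρ' i) (from (base ρ' j) z)                        ∎

  module IntersectingFamily {S : List (Sym Ω)} (S∈W : All (Wreath G H) S)
                            (S-distinct : AllPairs (λ π τ → ¬ π ≈ₚ τ) S) (S-intersecting : AllPairs Intersect S) where

    elts : List Elt
    elts = All.toList S∈W

    length-elts : length elts ≡ length S
    length-elts = trans (sym (length-map perm elts)) (cong length (map-proj₁-toList S∈W))

    pairwise-on-perm : ∀ {R : Rel (Sym Ω) 0ℓ} → AllPairs R S → AllPairs (λ e e' → R (perm e) (perm e')) elts
    pairwise-on-perm R-S = AllPairs.map⁻ (subst (AllPairs _) (sym (map-proj₁-toList S∈W)) R-S)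

    elts-agree : AllPairs (λ e e' → Agree (perm e) (perm e')) elts
    elts-agree = pairwise-on-perm (AllPairs.map (λ {π} {τ} → intersect⇒agree {π = π} {τ}) S-intersecting)

    _≟ₘ_ : Decidable (_≈ₚ_ {Fin m})
    _≟ₘ_ = DecSetoid._≟_ (≈ₚ-decSetoid m)

    _≟ₙ_ : Decidable (_≈ₚ_ {Fin n})
    _≟ₙ_ = DecSetoid._≟_ (≈ₚ-decSetoid n)

    tops : List (Sym (Fin n))
    tops = deduplicate _≟ₙ_ (map top elts)

    tops-intersecting : IsIntersecting H tops
    tops-intersecting =
      (All.deduplicate⁺ _≟ₙ_ (All.map⁺ (All.universal top∈H elts)) , deduplicate-! (≈ₚ-decSetoid n) _) ,
      AllPairs-deduplicate⁺ _≟ₙ_ (AllPairs.map⁺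
        (AllPairs.map (λ {e} {e'} agree → agree⇒intersect {π = top e} {top e'} (agree⇒agree-top {e} {e'} agree)) elts-agree))

    module _ (j : Fin n) where
      open Classes j
      open DecSetoid ∼-decSetoid using () renaming (_≟_ to _∼?_; sym to ∼-sym; trans to ∼-trans)
      open SetoidMembership cellSetoid using () renaming (_∈_ to _∈ᶜ_)

      classes : List Elt
      classes = deduplicate _∼?_ elts

      basesIn : Elt → List (Sym (Fin m))
      basesIn ρ = deduplicate _≟ₘ_ (map (λ e → base e j) (filter (_∼? ρ) elts))

      basesIn-intersecting : ∀ ρ → IsIntersecting G (basesIn ρ)
      basesIn-intersecting ρ =
        (All.deduplicate⁺ _≟ₘ_ (All.map⁺ (All.universal (λ e → base∈G e j) _)) , deduplicate-! (≈ₚ-decSetoid m) _) ,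
        AllPairs-deduplicate⁺ _≟ₘ_ (AllPairs.map⁺ (AllPairs.zipWith
          (λ {e} {e'} (e∼e' , agree) → agree⇒intersect {π = base e j} {base e' j} (∼∧agree⇒agree-base e∼e' agree))
          (same-class , AllPairs.filter⁺ _ elts-agree)))
        where
        same-class : AllPairs _∼_ (filter (_∼? ρ) elts)
        same-class = All⇒AllPairs (λ e∼ρ e'∼ρ → ∼-trans e∼ρ (∼-sym e'∼ρ)) (All.all-filter (_∼? ρ) elts)

      largestBases : List (Sym (Fin m))
      largestBases = argmax length [] (map basesIn classes)

      largestBases-intersecting : IsIntersecting G largestBases
      largestBases-intersecting =
        argmax-all length {P = IsIntersecting G} (([] , []) , []) (All.map⁺ (All.universal basesIn-intersecting classes))

      cellsOf : Elt → List Cell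
      cellsOf ρ = map (ρ ,_) (cartesianProduct (basesIn ρ) tops)

      cells : List Cell
      cells = concatMap cellsOf classes

      profile∈cells : ∀ {e} → e ∈ elts → profile e ∈ᶜ cells
      profile∈cells {e} e∈elts =
        Any.concatMap⁺ cellsOf (Any.map (λ e∼ρ → Any.map⁺ (Any.map (e∼ρ ,_)
            (Any.cartesianProduct⁺ (base∈basesIn e∼ρ) (∈⇒∈-deduplicate (≈ₚ-decSetoid n) (∈-map⁺ top e∈elts)))))
          (∈⇒∈-deduplicate ∼-decSetoid e∈elts))
        where
        base∈basesIn : ∀ {ρ} → e ∼ ρ → Any (base e j ≈ₚ_) (basesIn ρ)
        base∈basesIn {ρ} e∼ρ =
          ∈⇒∈-deduplicate (≈ₚ-decSetoid m) (∈-map⁺ (λ e → base e j) (∈-filter⁺ (_∼? ρ) e∈elts e∼ρ))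

      length-cells : length cells ≤ length classes * (length largestBases * length tops)
      length-cells = length-concatMap-≤ cellsOf (All.tabulate λ {ρ} ρ∈ → begin
        length (cellsOf ρ)                                       ≡⟨ length-map (ρ ,_) (cartesianProduct (basesIn ρ) tops) ⟩
        length (cartesianProduct (basesIn ρ) tops)               ≡⟨ length-cartesianProduct (basesIn ρ) tops ⟩
        length (basesIn ρ) * length tops                         ≤⟨ *-monoˡ-≤ (length tops) (All.lookup basesIn≤largest ρ∈) ⟩
        length largestBases * length tops                        ∎)
        where
        open ≤-Reasoning
        basesIn≤largest : All (λ ρ → length (basesIn ρ) ≤ length largestBases) classes
        basesIn≤largest = All.map⁻ (f[xs]≤f[argmax] {f = length} [] (map basesIn classes))

      length-S-bound : length S ≤ length classes * (length largestBases * length tops)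
      length-S-bound = begin
        length S     ≡⟨ sym length-elts ⟩
        length elts  ≤⟨ pigeonhole cellSetoid profile
                          (AllPairs.map (λ {e} {e'} e≉e' → e≉e' ∘ profile-injective {e} {e'}) (pairwise-on-perm S-distinct))
                          profile∈cells ⟩
        length cells ≤⟨ length-cells ⟩
        _            ∎
        where open ≤-Reasoning

      lifts : List (Sym (Fin m)) → List (Sym (Fin n)) → List (Sym Ω)
      lifts LG LH = map lift (cartesianProduct classes (cartesianProduct LG LH))

      length-lifts : ∀ LG LH → length (lifts LG LH) ≡ length classes * (length LG * length LH)
      length-lifts LG LH = begin
        length (lifts LG LH)                                     ≡⟨ length-map lift (cartesianProduct classes (cartesianProduct LG LH)) ⟩
        length (cartesianProduct classes (cartesianProduct LG LH)) ≡⟨ length-cartesianProduct classes _ ⟩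
        length classes * length (cartesianProduct LG LH)         ≡⟨ cong (length classes *_) (length-cartesianProduct LG LH) ⟩
        length classes * (length LG * length LH)                 ∎
        where open ≡-Reasoning

      lifts-stab : IsPermGroup G → ∀ {x LG LH} → IsSubsetOf (Stab G x) LG → IsSubsetOf (Stab H j) LH →
        IsSubsetOf (Stab (Wreath G H) (x , j)) (lifts LG LH)
      lifts-stab G-group {x} {LG} {LH} (LG-stab , LG-distinct) (LH-stab , LH-distinct) =
        All.map⁺ (All.tabulate lift∈) ,
        Unique.map⁺ cellSetoid (≈ₚ-setoid Ω) (λ {c} {c'} → lift-injective x {c} {c'})
          (Unique.cartesianProduct⁺ (DecSetoid.setoid ∼-decSetoid) (≈ₚ-setoid (Fin m) ×ₛ ≈ₚ-setoid (Fin n))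
            (deduplicate-! ∼-decSetoid elts) (Unique.cartesianProduct⁺ (≈ₚ-setoid (Fin m)) (≈ₚ-setoid (Fin n)) LG-distinct LH-distinct))
        where
        lift∈ : ∀ {c} → c ∈ cartesianProduct classes (cartesianProduct LG LH) → Stab (Wreath G H) (x , j) (lift c)
        lift∈ {ρ , u , h} c∈ with _ , uh∈ ← ∈-cartesianProduct⁻ classes _ c∈
                             with u∈ , h∈ ← ∈-cartesianProduct⁻ LG LH uh∈ =
          lift∈Stab G-group ρ (All.lookup LG-stab u∈) (All.lookup LH-stab h∈)

theorem6p4 : (m n : ℕ) (G : Sym (Fin m) → Set) (H : Sym (Fin n) → Set) →
    IsPermGroup G → IsPermGroup H → EKR G → EKR H →
    EKR (Wreath {m} {n} G H)
theorem6p4 m n G H G-group _ ekrG ekrH S ((S∈W , S-distinct) , S-intersecting) =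
  fromTopBound (ekrH tops tops-intersecting)
  where
  open WreathProduct G H
  open IntersectingFamily S∈W S-distinct S-intersecting

  fromTopBound : ∃[ j ] ∃[ LH ] (IsSubsetOf (Stab H j) LH × length tops ≤ length LH) →
    ∃[ ω ] ∃[ L ] (IsSubsetOf (Stab (Wreath G H) ω) L × length S ≤ length L)
  fromTopBound (j , LH , LH-stab , tops≤LH)
    with x , LG , LG-stab , largest≤LG ← ekrG (largestBases j) (largestBases-intersecting j) =
    (x , j) , lifts j LG LH , lifts-stab j G-group LG-stab LH-stab , (begin
      length S                                                     ≤⟨ length-S-bound j ⟩
      length (classes j) * (length (largestBases j) * length tops) ≤⟨ *-monoʳ-≤ (length (classes j)) (*-mono-≤ largest≤LG tops≤LH) ⟩
      length (classes j) * (length LG * length LH)                 ≡⟨ sym (length-lifts j LG LH) ⟩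
      length (lifts j LG LH)                                       ∎)
    where open ≤-Reasoning
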